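{- Let $X=\mathbb N\setminus 6\mathbb N$ (a Kirch-open subset of $\mathbb N$). There exists a locally LIP function on $X$ that is not a LIP function on $X$; i.e. $\mathcal{LIP}(X)\neq\mathrm{LIP}(X)$.
   Context: $\mathbb N=\{1,2,\dots\}$, $\mathbb N_0=\{0,1,2,\dots\}$. The Kirch topology on $\mathbb N$ has basis all arithmetic progressions $a+d\mathbb N_0$ with $a,d\in\mathbb N$, $\gcd(a,d)=1$, $d$ square-free. For infinite $Y\subseteq\mathbb Z$, $f:Y\to\mathbb Z$ is LIP if for every finite $Z\subseteq Y$ there is $p\in\mathbb Z[x]$ with $p=f$ on $Z$; $\mathrm{LIP}(Y)$ is the set of such. For a nonempty Kirch-open $Y\subseteq\mathbb N$, $f:Y\to\mathbb Z$ is locally LIP if every $a\in Y$ has a Kirch-open $Y_a\subseteq Y$ containing $a$ with $f|_{Y_a}$ LIP; $\mathcal{LIP}(Y)$ is the set of these. -}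

module Defs where

open import Level using (Level; _⊔_) renaming (suc to lsuc)
open import Data.Nat using (ℕ; zero; suc; _+_; _*_; _≥_)
open import Data.Nat.Divisibility using (_∣_)
open import Data.Nat.GCD using (gcd)
open import Data.Integer as ℤ using (ℤ; +_)
open import Data.List using (List; []; _∷_)
open import Data.List.Relation.Unary.All using (All)
open import Data.Product using (Σ; ∃; _×_)
open import Relation.Nullary using (¬_)
open import Relation.Binary.PropositionalEquality using (_≡_)

-- Subsets of ℕ = {1,2,...} (elements of Agda's ℕ that are ≥ 1) as predicates.
Subset : Set₁
Subset = ℕ → Set

_⊆_ : Subset → Subset → Set
U ⊆ V = ∀ n → U n → V n

SquareFree : ℕ → Set
SquareFree d = ∀ m → m * m ∣ d → m ≡ 1

AP : ℕ → ℕ → Subset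
AP a d n = ∃ λ k → n ≡ a + d * k

KirchBasic : ℕ → ℕ → Set
KirchBasic a d = (a ≥ 1) × (d ≥ 1) × (gcd a d ≡ 1) × SquareFree d

KirchOpen : Subset → Set
KirchOpen U = ∀ n → U n → Σ ℕ λ a → Σ ℕ λ d →
  KirchBasic a d × AP a d n × (AP a d ⊆ U)

Poly : Set
Poly = List ℤ

eval : Poly → ℤ → ℤ
eval []       x = + 0
eval (c ∷ cs) x = c ℤ.+ x ℤ.* eval cs x

-- f : Y → ℤ is represented by a function ℕ → ℤ; only its values on Y matter.
-- LIP: for every finite Z ⊆ Y there is p ∈ ℤ[x] with p = f on Z.
LIP : Subset → (ℕ → ℤ) → Set
LIP Y f = (Z : List ℕ) → All Y Z →
  Σ Poly λ p → All (λ z → eval p (+ z) ≡ f z) Z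

LocallyLIP : Subset → (ℕ → ℤ) → Set₁
LocallyLIP Y f = ∀ a → Y a → Σ Subset λ Ya →
  KirchOpen Ya × (Ya ⊆ Y) × Ya a × LIP Ya f

X : Subset
X n = (n ≥ 1) × ¬ (6 ∣ n)

-- Let σ n = −1 for n ≡ 4 (mod 6) and σ n = 1 otherwise, put L r = ((2r − 1)!!)^(2^r), and let
-- f n = ∑ᵣ Δʳσ(0) · L r · C(n, r), a perturbation of the Newton series σ n = ∑ᵣ Δʳσ(0) · C(n, r).
-- Since L r ≡ 1 (mod 2^(r+1)), f 8 − f 4 ≡ σ 8 − σ 4 = 2 (mod 4), whereas 8 − 4 divides p 8 − p 4
-- for every integer polynomial p; so f is not LIP on X.
-- Fix a bound M. As r! divides 2^r (2r − 1)!!, for n ≤ M both 2^M · f n and D · (f n − σ n), with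
-- the odd number D = 3^M (2M − 1)!!, are values of integer polynomials. X is covered by the open
-- sets 1 + 2ℕ₀, 2 + 3ℕ₀ and 1 + 3ℕ₀; D σ is constant on the first two, and at n = 1 + 3k it equals
-- D (1 − 2)^k = ∑ⱼ (−1)^j · D 2^j · C(k, j), a polynomial in n because 3^j j! divides D 2^j.
-- Since D is coprime to 2^M, f itself agrees with an integer polynomial on each of these sets up to M.

module Submission where

open import Defs
open import Data.Nat using (ℕ; zero; suc; _∸_; _≤_; _<_; _!; z≤n; s≤s)
import Data.Nat as ℕ
import Data.Nat.Properties as ℕP
open import Data.Nat.Combinatorics
  using (_C_; _P_; k>n⇒nCk≡0; nCk+nC[k+1]≡[n+1]C[k+1]; nPk≡n!/[n∸k]!; nCk≡nPk/k!; k![n∸k]!∣n!)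
open import Data.Nat.Combinatorics.Base using (_P′_)
open import Data.Nat.Divisibility as ℕ∣ using (divides)
open import Data.Nat.DivMod using (m*[n/m]≡n)
import Data.Nat.Tactic.RingSolver as ℕ-Solver
open import Data.Nat.Primality using (Irreducible; irreducible⇒nonZero; irreducible[2]; irreducible?)
open import Data.Integer as ℤ using (ℤ; +_; 0ℤ; 1ℤ; -1ℤ)
import Data.Integer.Properties as ℤP
import Data.Integer.Divisibility.Signed as ℤ∣
open import Data.Bool using (true)
open import Data.Empty using (⊥-elim)
open import Data.Product using (Σ; ∃; _×_; _,_; proj₁; proj₂)
open import Data.Sum using (_⊎_; inj₁; inj₂)
open import Data.List using ([]; _∷_)
open import Data.List.Relation.Unary.All as All using ([]; _∷_)
open import Data.List.Extrema.Nat using (max; xs≤max)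
open import Function using (_∘_)
open import Relation.Nullary using (¬_; Dec; yes; no)
open import Relation.Nullary.Decidable using (from-yes; from-no)
open import Relation.Binary.PropositionalEquality

-- Congruences to 1, odd double factorials and falling factorials

module _ where
  open import Data.Nat using (_+_; _*_; _^_; _≤ᵇ_; _/_)
  open import Data.Nat.Properties
  open import Data.Nat.Divisibility
  open import Data.Nat.Tactic.RingSolver using (solve-∀)

  infix 4 _≡1mod_

  record _≡1mod_ (u m : ℕ) : Set where
    constructor _,_
    field
      quotient : ℕ
      equality : u ≡ 1 + m * quotient

  ≡1mod-* : ∀ {a b m} → a ≡1mod m → b ≡1mod m → a * b ≡1mod m
  ≡1mod-* {m = m} (q , refl) (q′ , refl) = q + q′ + m * q * q′ , expand m q q′
    where
    expand : ∀ m q q′ → (1 + m * q) * (1 + m * q′) ≡ 1 + m * (q + q′ + m * q * q′)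
    expand = solve-∀

  ≡1mod-^ : ∀ {a m} → a ≡1mod m → ∀ n → a ^ n ≡1mod m
  ≡1mod-^ {m = m} _ zero = 0 , cong suc (sym (*-zeroʳ m))
  ≡1mod-^ a≡1 (suc n)    = ≡1mod-* a≡1 (≡1mod-^ a≡1 n)

  ≡1mod-square : ∀ {a m} → a ≡1mod 2 * m → a * a ≡1mod 2 * (2 * m)
  ≡1mod-square {m = m} (q , refl) = q + m * q * q , expand m q
    where
    expand : ∀ m q → (1 + 2 * m * q) * (1 + 2 * m * q) ≡ 1 + 2 * (2 * m) * (q + m * q * q)
    expand = solve-∀

  odd^2^n≡1mod2^[1+n] : ∀ {a} → a ≡1mod 2 → ∀ n → a ^ 2 ^ n ≡1mod 2 ^ suc n
  odd^2^n≡1mod2^[1+n] {a} (q , refl) zero    =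
    q , trans (*-identityʳ a) (cong (λ t → suc (t * q)) (sym (*-identityʳ 2)))
  odd^2^n≡1mod2^[1+n] {a} a≡1        (suc n) = subst (_≡1mod 2 ^ suc (suc n)) (sym a^[2e]≡a^e*a^e)
    (≡1mod-square {m = 2 ^ n} (odd^2^n≡1mod2^[1+n] a≡1 n))
    where
    a^[2e]≡a^e*a^e : a ^ (2 * 2 ^ n) ≡ a ^ 2 ^ n * a ^ 2 ^ n
    a^[2e]≡a^e*a^e = trans (cong (λ e → a ^ (2 ^ n + e)) (+-identityʳ (2 ^ n)))
                           (^-distribˡ-+-* a (2 ^ n) (2 ^ n))

  ^-monoʳ-∣ : ∀ m {n o} → n ≤ o → m ^ n ∣ m ^ o
  ^-monoʳ-∣ m {n} {o} n≤o = divides (m ^ (o ∸ n)) (begin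
    m ^ o               ≡⟨ cong (m ^_) (m+[n∸m]≡n n≤o) ⟨
    m ^ (n + (o ∸ n))   ≡⟨ ^-distribˡ-+-* m n (o ∸ n) ⟩
    m ^ n * m ^ (o ∸ n) ≡⟨ *-comm (m ^ n) _ ⟩
    m ^ (o ∸ n) * m ^ n ∎)
    where open ≡-Reasoning

  oddFactorial : ℕ → ℕ
  oddFactorial zero    = 1
  oddFactorial (suc r) = suc (2 * r) * oddFactorial r

  oddFactorial≡1mod2 : ∀ r → oddFactorial r ≡1mod 2
  oddFactorial≡1mod2 zero    = 0 , refl
  oddFactorial≡1mod2 (suc r) = ≡1mod-* (r , refl) (oddFactorial≡1mod2 r)

  oddFactorial-mono-∣ : ∀ {r} M → r ≤ M → oddFactorial r ∣ oddFactorial M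
  oddFactorial-mono-∣ M r≤M with m≤n⇒m<n∨m≡n r≤M
  oddFactorial-mono-∣ (suc M) _ | inj₁ (s≤s r≤M) =
    ∣-trans (oddFactorial-mono-∣ M r≤M) (n∣m*n (suc (2 * M)))
  ... | inj₂ refl = ∣-refl

  [2r]!≡2^r*r!*oddFactorial[r] : ∀ r → (2 * r) ! ≡ 2 ^ r * r ! * oddFactorial r
  [2r]!≡2^r*r!*oddFactorial[r] zero    = refl
  [2r]!≡2^r*r!*oddFactorial[r] (suc r) = begin
    (2 * suc r) !                                   ≡⟨ cong _! (*-suc 2 r) ⟩
    (2 + 2 * r) * ((1 + 2 * r) * (2 * r) !)          ≡⟨ cong (λ t → (2 + 2 * r) * ((1 + 2 * r) * t)) IH ⟩
    (2 + 2 * r) * ((1 + 2 * r) * (2 ^ r * r ! * o))  ≡⟨ regroup r (2 ^ r) (r !) o ⟩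
    2 * 2 ^ r * (suc r * r !) * ((1 + 2 * r) * o)    ∎
    where
    open ≡-Reasoning
    o = oddFactorial r
    IH = [2r]!≡2^r*r!*oddFactorial[r] r
    regroup : ∀ r p f o → (2 + 2 * r) * ((1 + 2 * r) * (p * f * o))
                        ≡ 2 * p * ((1 + r) * f) * ((1 + 2 * r) * o)
    regroup = solve-∀

  r!∣2^r*oddFactorial[r] : ∀ r → r ! ∣ 2 ^ r * oddFactorial r
  r!∣2^r*oddFactorial[r] r = *-cancelˡ-∣ (r !) {{r !≢0}} (begin
    r ! * r !                       ≡⟨ cong (λ t → r ! * t !) 2r∸r≡r ⟨
    r ! * (2 * r ∸ r) !             ∣⟨ k![n∸k]!∣n! (m≤m+n r (r + 0)) ⟩
    (2 * r) !                       ≡⟨ [2r]!≡2^r*r!*oddFactorial[r] r ⟩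
    2 ^ r * r ! * oddFactorial r    ≡⟨ regroup (2 ^ r) (r !) (oddFactorial r) ⟩
    r ! * (2 ^ r * oddFactorial r)  ∎)
    where
    open ∣-Reasoning
    2r∸r≡r : 2 * r ∸ r ≡ r
    2r∸r≡r = trans (m+n∸m≡n r (r + 0)) (+-identityʳ r)
    regroup : ∀ p f o → p * f * o ≡ f * (p * o)
    regroup = solve-∀

  r!∣2^r*oddFactorial[M] : ∀ {r} M → r ≤ M → r ! ∣ 2 ^ r * oddFactorial M
  r!∣2^r*oddFactorial[M] {r} M r≤M =
    ∣-trans (r!∣2^r*oddFactorial[r] r) (*-monoʳ-∣ (2 ^ r) (oddFactorial-mono-∣ M r≤M))

  n<k⇒nP′k≡0 : ∀ {n k} → n < k → n P′ k ≡ 0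
  n<k⇒nP′k≡0 {n} {suc k} (s≤s n≤k) with m≤n⇒m<n∨m≡n n≤k
  ... | inj₁ n<k  = trans (cong ((n ∸ k) *_) (n<k⇒nP′k≡0 n<k)) (*-zeroʳ (n ∸ k))
  ... | inj₂ refl = cong (_* (n P′ n)) (n∸n≡0 n)

  k≤n⇒nP′k≡nPk : ∀ {n k} → k ≤ n → n P′ k ≡ n P k
  k≤n⇒nP′k≡nPk {n} {k} k≤n with k ≤ᵇ n | ≤⇒≤ᵇ k≤n
  ... | true | _ = refl

  k≤n⇒k!∣nPk : ∀ {n k} → k ≤ n → k ! ∣ n P k
  k≤n⇒k!∣nPk {n} {k} k≤n = subst (k ! ∣_) (sym (nPk≡n!/[n∸k]! k≤n))
    (m*n∣o⇒m∣o/n (k !) ((n ∸ k) !) {{(n ∸ k) !≢0}} (k![n∸k]!∣n! k≤n))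

  nP′k≡k!*nCk : ∀ n k → n P′ k ≡ k ! * (n C k)
  nP′k≡k!*nCk n k with k ≤? n
  ... | no k≰n = begin
    n P′ k          ≡⟨ n<k⇒nP′k≡0 (≰⇒> k≰n) ⟩
    0               ≡⟨ *-zeroʳ (k !) ⟨
    k ! * 0         ≡⟨ cong (k ! *_) (k>n⇒nCk≡0 (≰⇒> k≰n)) ⟨
    k ! * (n C k)   ∎
    where open ≡-Reasoning
  ... | yes k≤n = begin
    n P′ k                 ≡⟨ k≤n⇒nP′k≡nPk k≤n ⟩
    n P k                  ≡⟨ m*[n/m]≡n (k≤n⇒k!∣nPk k≤n) ⟨
    k ! * ((n P k) / k !)  ≡⟨ cong (k ! *_) (nCk≡nPk/k! k≤n) ⟨
    k ! * (n C k)          ∎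
    where
    open ≡-Reasoning
    instance _ = k !≢0

module _ where
  open import Data.Nat using (_+_; _*_; _^_)
  open import Data.Nat.Properties
  open import Data.Nat.Divisibility
  open import Data.Nat.Tactic.RingSolver using (solve-∀)

  L : ℕ → ℕ
  L r = oddFactorial r ^ 2 ^ r

  L[r]≡1mod2^[1+r] : ∀ r → L r ≡1mod 2 ^ suc r
  L[r]≡1mod2^[1+r] r = odd^2^n≡1mod2^[1+n] (oddFactorial≡1mod2 r) r

  L[r]≡1+[L[r]∸1] : ∀ r → L r ≡ 1 + (L r ∸ 1)
  L[r]≡1+[L[r]∸1] r with L[r]≡1mod2^[1+r] r
  ... | q , Lr≡1+2^[1+r]q = sym (m+[n∸m]≡n (subst (1 ≤_) (sym Lr≡1+2^[1+r]q) (s≤s z≤n)))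

  D : ℕ → ℕ
  D M = 3 ^ M * oddFactorial M

  D[M]≡1mod2 : ∀ M → D M ≡1mod 2
  D[M]≡1mod2 M = ≡1mod-* (≡1mod-^ (1 , refl) M) (oddFactorial≡1mod2 M)

  D[M]∣1+2^M*y : ∀ M → ∃ λ y → D M ∣ 1 + 2 ^ M * y
  D[M]∣1+2^M*y M with odd^2^n≡1mod2^[1+n] (D[M]≡1mod2 M) M
  ... | q , D^2^M≡1+2^[1+M]q = 2 * q , (begin
    D M                   ∣⟨ ∣-reflexive (sym (*-identityʳ (D M))) ⟩
    D M ^ 1               ∣⟨ ^-monoʳ-∣ (D M) (m^n>0 2 M) ⟩
    D M ^ 2 ^ M           ≡⟨ D^2^M≡1+2^[1+M]q ⟩
    1 + 2 * 2 ^ M * q     ≡⟨ cong suc (regroup (2 ^ M) q) ⟩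
    1 + 2 ^ M * (2 * q)   ∎)
    where
    open ∣-Reasoning
    regroup : ∀ p q → 2 * p * q ≡ p * (2 * q)
    regroup = solve-∀

  r!∣2^M*L[r] : ∀ {r} M → r ≤ M → r ! ∣ 2 ^ M * L r
  r!∣2^M*L[r] {r} M r≤M =
    ∣-trans (r!∣2^r*oddFactorial[r] r) (*-pres-∣ (^-monoʳ-∣ 2 r≤M) oddFactorial[r]∣L[r])
    where
    oddFactorial[r]∣L[r] : oddFactorial r ∣ L r
    oddFactorial[r]∣L[r] =
      ∣-trans (∣-reflexive (sym (*-identityʳ (oddFactorial r)))) (^-monoʳ-∣ (oddFactorial r) (m^n>0 2 r))

  r!∣D[M]*[L[r]∸1] : ∀ {r} M → r ≤ M → r ! ∣ D M * (L r ∸ 1)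
  r!∣D[M]*[L[r]∸1] {r} M r≤M with L[r]≡1mod2^[1+r] r
  ... | q , Lr≡1+2^[1+r]q = begin
    r !                                        ∣⟨ r!∣2^r*oddFactorial[M] M r≤M ⟩
    2 ^ r * oddFactorial M                     ∣⟨ m∣m*n (3 ^ M * (2 * q)) ⟩
    2 ^ r * oddFactorial M * (3 ^ M * (2 * q))  ≡⟨ regroup (2 ^ r) (oddFactorial M) (3 ^ M) q ⟩
    D M * (2 * 2 ^ r * q)                      ≡⟨ cong (λ t → D M * t) (m+n∸m≡n 1 _) ⟨
    D M * (1 + 2 ^ suc r * q ∸ 1)              ≡⟨ cong (λ t → D M * (t ∸ 1)) Lr≡1+2^[1+r]q ⟨
    D M * (L r ∸ 1)                            ∎
    where
    open ∣-Reasoning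
    regroup : ∀ p o t q → p * o * (t * (2 * q)) ≡ t * o * (2 * p * q)
    regroup = solve-∀

  3^j*j!∣D[M]*2^j : ∀ {j} M → j ≤ M → 3 ^ j * j ! ∣ D M * 2 ^ j
  3^j*j!∣D[M]*2^j {j} M j≤M = begin
    3 ^ j * j !                       ∣⟨ *-pres-∣ (^-monoʳ-∣ 3 j≤M) (r!∣2^r*oddFactorial[M] M j≤M) ⟩
    3 ^ M * (2 ^ j * oddFactorial M)  ≡⟨ regroup (3 ^ M) (2 ^ j) (oddFactorial M) ⟩
    D M * 2 ^ j                       ∎
    where
    open ∣-Reasoning
    regroup : ∀ t p o → t * (p * o) ≡ t * o * p
    regroup = solve-∀

-- Basic open sets of the Kirch topology covering X

module _ where
  open import Data.Nat using (_+_; _*_; >-nonZero)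
  open import Data.Nat.Properties
  open import Data.Nat.Divisibility
  open import Data.Nat.Tactic.RingSolver using (solve-∀)

  irreducible⇒squareFree : ∀ {p} → Irreducible p → SquareFree p
  irreducible⇒squareFree {p} irr m m*m∣p with irr (m*n∣⇒m∣ m m m*m∣p)
  ... | inj₁ m≡1  = m≡1
  ... | inj₂ refl = ∣1⇒≡1 (*-cancelˡ-∣ m {{irreducible⇒nonZero irr}}
                                        (subst (m * m ∣_) (sym (*-identityʳ m)) m*m∣p))

  basic⇒open : ∀ {a d} → KirchBasic a d → KirchOpen (AP a d)
  basic⇒open {a} {d} basic n n∈AP = a , d , basic , n∈AP , λ _ m∈AP → m∈AP

  squareFree[3] : SquareFree 3
  squareFree[3] = irreducible⇒squareFree (from-yes (irreducible? 3))

  basic[1,2] : KirchBasic 1 2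
  basic[1,2] = s≤s z≤n , s≤s z≤n , refl , irreducible⇒squareFree irreducible[2]

  basic[2,3] : KirchBasic 2 3
  basic[2,3] = s≤s z≤n , s≤s z≤n , refl , squareFree[3]

  basic[1,3] : KirchBasic 1 3
  basic[1,3] = s≤s z≤n , s≤s z≤n , refl , squareFree[3]

  AP⊆X : ∀ {a d} → 0 < a → a < d → d ∣ 6 → AP a d ⊆ X
  AP⊆X {a} {d} 0<a a<d d∣6 n (k , refl) = ≤-trans 0<a (m≤m+n a (d * k)) , λ 6∣n →
    <⇒≱ a<d (∣⇒≤ {{>-nonZero 0<a}}
      (∣m+n∣m⇒∣n (subst (d ∣_) (+-comm a (d * k)) (∣-trans d∣6 6∣n)) (m∣m*n k)))

  X-cover : ∀ n → ¬ 6 ∣ n → AP 1 2 n ⊎ AP 2 3 n ⊎ AP 1 3 n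
  X-cover 0 6∤n = ⊥-elim (6∤n (6 ∣0))
  X-cover 1 _ = inj₁ (0 , refl)
  X-cover 2 _ = inj₂ (inj₁ (0 , refl))
  X-cover 3 _ = inj₁ (1 , refl)
  X-cover 4 _ = inj₂ (inj₂ (1 , refl))
  X-cover 5 _ = inj₁ (2 , refl)
  X-cover (suc (suc (suc (suc (suc (suc n)))))) 6∤6+n with X-cover n (6∤6+n ∘ ∣m∣n⇒∣m+n ∣-refl)
  ... | inj₁ (k , refl)        = inj₁ (3 + k , shift₁₂ k)
    where
    shift₁₂ : ∀ k → 6 + (1 + 2 * k) ≡ 1 + 2 * (3 + k)
    shift₁₂ = solve-∀
  ... | inj₂ (inj₁ (k , refl)) = inj₂ (inj₁ (2 + k , shift₂₃ k))
    where
    shift₂₃ : ∀ k → 6 + (2 + 3 * k) ≡ 2 + 3 * (2 + k)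
    shift₂₃ = solve-∀
  ... | inj₂ (inj₂ (k , refl)) = inj₂ (inj₂ (2 + k , shift₁₃ k))
    where
    shift₁₃ : ∀ k → 6 + (1 + 3 * k) ≡ 1 + 3 * (2 + k)
    shift₁₃ = solve-∀

-- From here on the arithmetic operators are those of ℤ; those of ℕ are qualified.
open import Data.Integer using (-_; _+_; _*_; _-_; _^_)
open import Data.Integer.Tactic.RingSolver using (solve-∀)

-- Finite sums and Newton's forward-difference formula

∑≤ : ℕ → (ℕ → ℤ) → ℤ
∑≤ zero    F = F 0
∑≤ (suc M) F = F 0 + ∑≤ M (λ r → F (suc r))

syntax ∑≤ M (λ r → e) = ∑[ r ≤ M ] e

∑-cong : ∀ M {F G : ℕ → ℤ} → (∀ r → r ≤ M → F r ≡ G r) → ∑≤ M F ≡ ∑≤ M G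
∑-cong zero    F≗G = F≗G 0 z≤n
∑-cong (suc M) F≗G = cong₂ _+_ (F≗G 0 z≤n) (∑-cong M (λ r r≤M → F≗G (suc r) (s≤s r≤M)))

∑-distrib-+ : ∀ M (F G : ℕ → ℤ) → ∑[ r ≤ M ] (F r + G r) ≡ ∑≤ M F + ∑≤ M G
∑-distrib-+ zero    F G = refl
∑-distrib-+ (suc M) F G =
  trans (cong (_+_ (F 0 + G 0)) (∑-distrib-+ M (λ r → F (suc r)) (λ r → G (suc r))))
        (interchange (F 0) (G 0) _ _)
  where
  interchange : ∀ a b c d → a + b + (c + d) ≡ a + c + (b + d)
  interchange = solve-∀

*-distribˡ-∑ : ∀ M c (F : ℕ → ℤ) → c * ∑≤ M F ≡ ∑[ r ≤ M ] (c * F r)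
*-distribˡ-∑ zero    c F = refl
*-distribˡ-∑ (suc M) c F =
  trans (ℤP.*-distribˡ-+ c (F 0) _) (cong (_+_ (c * F 0)) (*-distribˡ-∑ M c (λ r → F (suc r))))

∑-zero : ∀ M {F : ℕ → ℤ} → (∀ r → F r ≡ 0ℤ) → ∑≤ M F ≡ 0ℤ
∑-zero zero    F≗0 = F≗0 0
∑-zero (suc M) F≗0 = cong₂ _+_ (F≗0 0) (∑-zero M (λ r → F≗0 (suc r)))

∑-extend : ∀ {n M} (F : ℕ → ℤ) → n ≤ M → (∀ r → n < r → F r ≡ 0ℤ) → ∑≤ M F ≡ ∑≤ n F
∑-extend {M = zero}  F z≤n       F≗0 = refl
∑-extend {M = suc M} F z≤n       F≗0 =
  trans (cong (_+_ (F 0)) (∑-zero M (λ r → F≗0 (suc r) (s≤s z≤n)))) (ℤP.+-identityʳ (F 0))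
∑-extend             F (s≤s n≤M) F≗0 =
  cong (_+_ (F 0)) (∑-extend (λ r → F (suc r)) n≤M (λ r n<r → F≗0 (suc r) (s≤s n<r)))

Δ : (ℕ → ℤ) → ℕ → ℕ → ℤ
Δ h zero    n = h n
Δ h (suc r) n = Δ h r (suc n) - Δ h r n

Δ-shift : ∀ h r n → Δ (λ m → h (suc m)) r n ≡ Δ h r (suc n)
Δ-shift h zero    n = refl
Δ-shift h (suc r) n = cong₂ _-_ (Δ-shift h r (suc n)) (Δ-shift h r n)

n<r⇒c*nCr≡0 : ∀ c {n r} → n < r → c * + (n C r) ≡ 0ℤ
n<r⇒c*nCr≡0 c n<r = trans (cong (λ m → c * + m) (k>n⇒nCk≡0 n<r)) (ℤP.*-zeroʳ c)

newton-forward-exact : ∀ h n → h n ≡ ∑[ r ≤ n ] (Δ h r 0 * + (n C r))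
newton-forward-exact h zero    = sym (ℤP.*-identityʳ (h 0))
newton-forward-exact h (suc n) = begin
  h (suc n)
    ≡⟨ newton-forward-exact (λ m → h (suc m)) n ⟩
  ∑[ r ≤ n ] (Δ (λ m → h (suc m)) r 0 * + (n C r))
    ≡⟨ ∑-cong n (λ r _ → step r) ⟩
  ∑[ r ≤ n ] (G r * + (n C r) + G (suc r) * + (n C r))
    ≡⟨ ∑-distrib-+ n _ _ ⟩
  A + B
    ≡⟨ cong (_+ B) A≡G0+B′ ⟩
  G 0 * 1ℤ + B′ + B
    ≡⟨ ℤP.+-assoc (G 0 * 1ℤ) B′ B ⟩
  G 0 * 1ℤ + (B′ + B)
    ≡⟨ cong (_+_ (G 0 * 1ℤ)) (∑-distrib-+ n _ _) ⟨
  G 0 * 1ℤ + ∑[ r ≤ n ] (G (suc r) * + (n C suc r) + G (suc r) * + (n C r))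
    ≡⟨ cong (_+_ (G 0 * 1ℤ)) (∑-cong n (λ r _ → pascal r)) ⟩
  G 0 * 1ℤ + ∑[ r ≤ n ] (G (suc r) * + (suc n C suc r))
    ∎
  where
  open ≡-Reasoning
  G : ℕ → ℤ
  G r = Δ h r 0
  A = ∑[ r ≤ n ] (G r * + (n C r))
  B = ∑[ r ≤ n ] (G (suc r) * + (n C r))
  B′ = ∑[ r ≤ n ] (G (suc r) * + (n C suc r))
  A≡G0+B′ : A ≡ G 0 * 1ℤ + B′
  A≡G0+B′ = sym (∑-extend _ (ℕP.n≤1+n n) (λ r → n<r⇒c*nCr≡0 (G r)))
  step : ∀ r → Δ (λ m → h (suc m)) r 0 * + (n C r) ≡ G r * + (n C r) + G (suc r) * + (n C r)
  step r = trans (cong (_* + (n C r)) (trans (Δ-shift h r 0) (x≡y+[x-y] (Δ h r 1) (G r))))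
                 (ℤP.*-distribʳ-+ (+ (n C r)) (G r) (G (suc r)))
    where
    x≡y+[x-y] : ∀ x y → x ≡ y + (x - y)
    x≡y+[x-y] = solve-∀
  pascal : ∀ r → G (suc r) * + (n C suc r) + G (suc r) * + (n C r) ≡ G (suc r) * + (suc n C suc r)
  pascal r = begin
    G′ * + (n C suc r) + G′ * + (n C r)  ≡⟨ ℤP.*-distribˡ-+ G′ _ _ ⟨
    G′ * (+ (n C suc r) + + (n C r))     ≡⟨ cong (G′ *_) (ℤP.+-comm (+ (n C suc r)) (+ (n C r))) ⟩
    G′ * (+ (n C r) + + (n C suc r))     ≡⟨ cong (G′ *_) (ℤP.pos-+ (n C r) (n C suc r)) ⟨
    G′ * + (n C r ℕ.+ n C suc r)         ≡⟨ cong (λ m → G′ * + m) (nCk+nC[k+1]≡[n+1]C[k+1] n r) ⟩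
    G′ * + (suc n C suc r)               ∎
    where G′ = G (suc r)

newton-forward : ∀ h {n M} → n ≤ M → h n ≡ ∑[ r ≤ M ] (Δ h r 0 * + (n C r))
newton-forward h {n} n≤M =
  trans (newton-forward-exact h n) (sym (∑-extend _ n≤M (λ r → n<r⇒c*nCr≡0 (Δ h r 0))))

Δ-alternating : ∀ j n → Δ (-1ℤ ^_) j n ≡ -1ℤ ^ j * + (2 ℕ.^ j) * -1ℤ ^ n
Δ-alternating zero    n = sym (ℤP.*-identityˡ (-1ℤ ^ n))
Δ-alternating (suc j) n = begin
  Δ (-1ℤ ^_) j (suc n) - Δ (-1ℤ ^_) j n
    ≡⟨ cong₂ _-_ (Δ-alternating j (suc n)) (Δ-alternating j n) ⟩
  s * + (2 ℕ.^ j) * (-1ℤ * t) - s * + (2 ℕ.^ j) * t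
    ≡⟨ doubling s (+ (2 ℕ.^ j)) t ⟩
  -1ℤ * s * (+ 2 * + (2 ℕ.^ j)) * t
    ≡⟨ cong (λ m → -1ℤ * s * m * t) (ℤP.pos-* 2 (2 ℕ.^ j)) ⟨
  -1ℤ * s * + (2 ℕ.* 2 ℕ.^ j) * t
    ∎
  where
  open ≡-Reasoning
  s = -1ℤ ^ j
  t = -1ℤ ^ n
  doubling : ∀ s p t → s * p * (-1ℤ * t) - s * p * t ≡ -1ℤ * s * (+ 2 * p) * t
  doubling = solve-∀

-- Integer polynomials and functions that agree with one on a set

infixl 6 _⊕_

_⊕_ : Poly → Poly → Poly
[]      ⊕ q       = q
(a ∷ p) ⊕ []      = a ∷ p
(a ∷ p) ⊕ (b ∷ q) = a + b ∷ p ⊕ q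

eval-⊕ : ∀ p q x → eval (p ⊕ q) x ≡ eval p x + eval q x
eval-⊕ []      q       x = sym (ℤP.+-identityˡ (eval q x))
eval-⊕ (a ∷ p) []      x = sym (ℤP.+-identityʳ (eval (a ∷ p) x))
eval-⊕ (a ∷ p) (b ∷ q) x = trans (cong (λ s → a + b + x * s) (eval-⊕ p q x)) (regroup a b x _ _)
  where
  regroup : ∀ a b x s t → a + b + x * (s + t) ≡ a + x * s + (b + x * t)
  regroup = solve-∀

scale : ℤ → Poly → Poly
scale c []      = []
scale c (a ∷ p) = c * a ∷ scale c p

eval-scale : ∀ c p x → eval (scale c p) x ≡ c * eval p x
eval-scale c []      x = sym (ℤP.*-zeroʳ c)
eval-scale c (a ∷ p) x = trans (cong (λ s → c * a + x * s) (eval-scale c p x)) (regroup c a x _)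
  where
  regroup : ∀ c a x s → c * a + x * (c * s) ≡ c * (a + x * s)
  regroup = solve-∀

X+_*ₚ_ : ℤ → Poly → Poly
X+ c *ₚ p = (0ℤ ∷ p) ⊕ scale c p

eval-X+*ₚ : ∀ c p x → eval (X+ c *ₚ p) x ≡ (x + c) * eval p x
eval-X+*ₚ c p x = begin
  eval ((0ℤ ∷ p) ⊕ scale c p) x            ≡⟨ eval-⊕ (0ℤ ∷ p) (scale c p) x ⟩
  0ℤ + x * eval p x + eval (scale c p) x  ≡⟨ cong (_+_ (0ℤ + x * eval p x)) (eval-scale c p x) ⟩
  0ℤ + x * eval p x + c * eval p x        ≡⟨ regroup c x (eval p x) ⟩
  (x + c) * eval p x                      ∎
  where
  open ≡-Reasoning
  regroup : ∀ c x s → 0ℤ + x * s + c * s ≡ (x + c) * s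
  regroup = solve-∀

PolynomialOn : {A : Set} → (A → Set) → (A → ℤ) → (A → ℤ) → Set
PolynomialOn S x G = Σ Poly λ p → ∀ a → S a → eval p (x a) ≡ G a

module _ {A : Set} {S : A → Set} {x : A → ℤ} where

  polynomialOn-const : ∀ c → PolynomialOn S x (λ _ → c)
  polynomialOn-const c = c ∷ [] , λ a _ →
    trans (cong (_+_ c) (ℤP.*-zeroʳ (x a))) (ℤP.+-identityʳ c)

  polynomialOn-+ : ∀ {G H} → PolynomialOn S x G → PolynomialOn S x H →
                   PolynomialOn S x (λ a → G a + H a)
  polynomialOn-+ (p , p≡G) (q , q≡H) = p ⊕ q , λ a Sa →
    trans (eval-⊕ p q (x a)) (cong₂ _+_ (p≡G a Sa) (q≡H a Sa))

  polynomialOn-scale : ∀ c {G} → PolynomialOn S x G → PolynomialOn S x (λ a → c * G a)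
  polynomialOn-scale c (p , p≡G) = scale c p , λ a Sa →
    trans (eval-scale c p (x a)) (cong (c *_) (p≡G a Sa))

  polynomialOn-∑ : ∀ M {G : ℕ → A → ℤ} → (∀ r → r ≤ M → PolynomialOn S x (G r)) →
                   PolynomialOn S x (λ a → ∑[ r ≤ M ] G r a)
  polynomialOn-∑ zero    poly = poly 0 z≤n
  polynomialOn-∑ (suc M) poly = polynomialOn-+ (poly 0 z≤n)
    (polynomialOn-∑ M (λ r r≤M → poly (suc r) (s≤s r≤M)))

  polynomialOn-cong : ∀ {G H} → (∀ a → S a → G a ≡ H a) →
                      PolynomialOn S x G → PolynomialOn S x H
  polynomialOn-cong G≗H (p , p≡G) = p , λ a Sa → trans (p≡G a Sa) (G≗H a Sa)

  polynomialOn-restrict : ∀ {T : A → Set} {G} → (∀ a → T a → S a) →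
                          PolynomialOn S x G → PolynomialOn T x G
  polynomialOn-restrict T⊆S (p , p≡G) = p , λ a Ta → p≡G a (T⊆S a Ta)

  polynomialOn-bézout : ∀ {a b y} {g : A → ℤ} → a ℕ∣.∣ 1 ℕ.+ b ℕ.* y →
                        PolynomialOn S x (λ n → + a * g n) → PolynomialOn S x (λ n → + b * g n) →
                        PolynomialOn S x g
  polynomialOn-bézout {a} {b} {y} {g} (divides c 1+by≡ca) ag bg =
    polynomialOn-cong combination
      (polynomialOn-+ (polynomialOn-scale (+ c) ag) (polynomialOn-scale (- + y) bg))
    where
    combination : ∀ n → S n → + c * (+ a * g n) + - + y * (+ b * g n) ≡ g n
    combination n _ = begin
      + c * (+ a * g n) + - + y * (+ b * g n)
        ≡⟨ regroup (+ c) (+ a) (+ y) (+ b) (g n) ⟩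
      (+ c * + a - + b * + y) * g n
        ≡⟨ cong₂ (λ s t → (s - t) * g n) (ℤP.pos-* c a) (ℤP.pos-* b y) ⟨
      (+ (c ℕ.* a) - + (b ℕ.* y)) * g n
        ≡⟨ cong (λ s → (+ s - + (b ℕ.* y)) * g n) 1+by≡ca ⟨
      (1ℤ + + (b ℕ.* y) - + (b ℕ.* y)) * g n
        ≡⟨ cancel (+ (b ℕ.* y)) (g n) ⟩
      g n
        ∎
      where
      open ≡-Reasoning
      regroup : ∀ c a y b g → c * (a * g) + - y * (b * g) ≡ (c * a - b * y) * g
      regroup = solve-∀
      cancel : ∀ t g → (1ℤ + t - t) * g ≡ g
      cancel = solve-∀

[a+d*m]-[a+d*n]≡d*[m∸n] : ∀ a d {m n} → n ≤ m →
                          + (a ℕ.+ d ℕ.* m) - + (a ℕ.+ d ℕ.* n) ≡ + (d ℕ.* (m ∸ n))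
[a+d*m]-[a+d*n]≡d*[m∸n] a d {m} {n} n≤m = begin
  + (a ℕ.+ d ℕ.* m) - + (a ℕ.+ d ℕ.* n)  ≡⟨ ℤP.m-n≡m⊖n (a ℕ.+ d ℕ.* m) (a ℕ.+ d ℕ.* n) ⟩
  (a ℕ.+ d ℕ.* m) ℤ.⊖ (a ℕ.+ d ℕ.* n)    ≡⟨ ℤP.+-cancelˡ-⊖ a (d ℕ.* m) (d ℕ.* n) ⟩
  (d ℕ.* m) ℤ.⊖ (d ℕ.* n)                ≡⟨ ℤP.⊖-≥ (ℕP.*-monoʳ-≤ d n≤m) ⟩
  + (d ℕ.* m ∸ d ℕ.* n)                  ≡⟨ cong +_ (ℕP.*-distribˡ-∸ d m n) ⟨
  + (d ℕ.* (m ∸ n))                      ∎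
  where open ≡-Reasoning

fallingPoly : ℕ → ℕ → ℕ → Poly
fallingPoly a d zero    = 1ℤ ∷ []
fallingPoly a d (suc j) = X+ - + (a ℕ.+ d ℕ.* j) *ₚ fallingPoly a d j

eval-fallingPoly : ∀ a d j k → eval (fallingPoly a d j) (+ (a ℕ.+ d ℕ.* k)) ≡ + (d ℕ.^ j ℕ.* (k P′ j))
eval-fallingPoly a d zero    k = cong (_+_ 1ℤ) (ℤP.*-zeroʳ (+ (a ℕ.+ d ℕ.* k)))
eval-fallingPoly a d (suc j) k = begin
  eval (fallingPoly a d (suc j)) x           ≡⟨ eval-X+*ₚ (- y) (fallingPoly a d j) x ⟩
  (x - y) * eval (fallingPoly a d j) x       ≡⟨ cong (_*_ (x - y)) (eval-fallingPoly a d j k) ⟩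
  (x - y) * + (d ℕ.^ j ℕ.* (k P′ j))          ≡⟨ new-factor (j ℕP.≤? k) ⟩
  + (d ℕ.^ suc j ℕ.* (k P′ suc j))            ∎
  where
  open ≡-Reasoning
  x = + (a ℕ.+ d ℕ.* k)
  y = + (a ℕ.+ d ℕ.* j)
  e = + (d ℕ.^ j ℕ.* (k P′ j))
  vanishes : ∀ i → k < i → d ℕ.^ i ℕ.* (k P′ i) ≡ 0
  vanishes i k<i = trans (cong (d ℕ.^ i ℕ.*_) (n<k⇒nP′k≡0 k<i)) (ℕP.*-zeroʳ (d ℕ.^ i))
  regroup : ∀ d m e p → d ℕ.* m ℕ.* (e ℕ.* p) ≡ d ℕ.* e ℕ.* (m ℕ.* p)
  regroup = ℕ-Solver.solve-∀
  new-factor : Dec (j ≤ k) → (x - y) * + (d ℕ.^ j ℕ.* (k P′ j)) ≡ + (d ℕ.^ suc j ℕ.* (k P′ suc j))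
  new-factor (yes j≤k) = begin
    (x - y) * e                                    ≡⟨ cong (_* e) ([a+d*m]-[a+d*n]≡d*[m∸n] a d j≤k) ⟩
    + (d ℕ.* (k ∸ j)) * e                          ≡⟨ ℤP.pos-* (d ℕ.* (k ∸ j)) _ ⟨
    + (d ℕ.* (k ∸ j) ℕ.* (d ℕ.^ j ℕ.* (k P′ j)))    ≡⟨ cong +_ (regroup d (k ∸ j) _ _) ⟩
    + (d ℕ.* d ℕ.^ j ℕ.* ((k ∸ j) ℕ.* (k P′ j)))    ∎
  new-factor (no j≰k) = begin
    (x - y) * + (d ℕ.^ j ℕ.* (k P′ j))  ≡⟨ cong (λ m → (x - y) * + m) (vanishes j (ℕP.≰⇒> j≰k)) ⟩
    (x - y) * 0ℤ                       ≡⟨ ℤP.*-zeroʳ (x - y) ⟩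
    0ℤ                                 ≡⟨ cong +_ (vanishes (suc j) (ℕP.m<n⇒m<1+n (ℕP.≰⇒> j≰k))) ⟨
    + (d ℕ.^ suc j ℕ.* (k P′ suc j))    ∎

binomial-polynomialOn : ∀ {S : ℕ → Set} a d j {c} → d ℕ.^ j ℕ.* j ! ℕ∣.∣ c →
                        PolynomialOn S (λ k → + (a ℕ.+ d ℕ.* k)) (λ k → + c * + (k C j))
binomial-polynomialOn a d j (divides q refl) = scale (+ q) (fallingPoly a d j) , λ k _ → begin
  eval (scale (+ q) (fallingPoly a d j)) (+ (a ℕ.+ d ℕ.* k))
    ≡⟨ eval-scale (+ q) (fallingPoly a d j) _ ⟩
  + q * eval (fallingPoly a d j) (+ (a ℕ.+ d ℕ.* k))
    ≡⟨ cong (+ q *_) (eval-fallingPoly a d j k) ⟩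
  + q * + (d ℕ.^ j ℕ.* (k P′ j))
    ≡⟨ cong (λ m → + q * + (d ℕ.^ j ℕ.* m)) (nP′k≡k!*nCk k j) ⟩
  + q * + (d ℕ.^ j ℕ.* (j ! ℕ.* (k C j)))
    ≡⟨ cong (_*_ (+ q)) (ℤP.pos-* (d ℕ.^ j) _) ⟩
  + q * (+ (d ℕ.^ j) * + (j ! ℕ.* (k C j)))
    ≡⟨ cong (λ t → + q * (+ (d ℕ.^ j) * t)) (ℤP.pos-* (j !) (k C j)) ⟩
  + q * (+ (d ℕ.^ j) * (+ (j !) * + (k C j)))
    ≡⟨ regroup (+ q) (+ (d ℕ.^ j)) (+ (j !)) (+ (k C j)) ⟩
  + q * (+ (d ℕ.^ j) * + (j !)) * + (k C j)
    ≡⟨ cong (λ t → + q * t * + (k C j)) (ℤP.pos-* (d ℕ.^ j) (j !)) ⟨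
  + q * + (d ℕ.^ j ℕ.* j !) * + (k C j)
    ≡⟨ cong (_* + (k C j)) (ℤP.pos-* q (d ℕ.^ j ℕ.* j !)) ⟨
  + (q ℕ.* (d ℕ.^ j ℕ.* j !)) * + (k C j)
    ∎
  where
  open ≡-Reasoning
  regroup : ∀ q e f c → q * (e * (f * c)) ≡ q * (e * f) * c
  regroup = solve-∀

binomial-polynomialOn₀ : ∀ {S : ℕ → Set} j {c} → j ! ℕ∣.∣ c → PolynomialOn S +_ (λ n → + c * + (n C j))
binomial-polynomialOn₀ {S} j {c} j!∣c = proj₁ poly , λ n Sn →
  trans (cong (λ m → eval (proj₁ poly) (+ m)) (sym (ℕP.*-identityˡ n))) (proj₂ poly n Sn)
  where
  j!≡1^j*j! : j ! ≡ 1 ℕ.^ j ℕ.* j !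
  j!≡1^j*j! = sym (trans (cong (ℕ._* j !) (ℕP.^-zeroˡ j)) (ℕP.*-identityˡ (j !)))
  poly : PolynomialOn S (λ k → + (0 ℕ.+ 1 ℕ.* k)) (λ k → + c * + (k C j))
  poly = binomial-polynomialOn 0 1 j (subst (ℕ∣._∣ c) j!≡1^j*j! j!∣c)

binomialSum-polynomialOn : ∀ {S : ℕ → Set} M (w : ℕ → ℤ) {c : ℕ → ℕ} →
                           (∀ r → r ≤ M → r ! ℕ∣.∣ c r) →
                           PolynomialOn S +_ (λ n → ∑[ r ≤ M ] (w r * (+ c r * + (n C r))))
binomialSum-polynomialOn M w r!∣c = polynomialOn-∑ M (λ r r≤M →
  polynomialOn-scale (w r) (binomial-polynomialOn₀ r (r!∣c r r≤M)))

-- Criteria for and against LIP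

infix 5 _∩[≤_]

_∩[≤_] : Subset → ℕ → Subset
(Y ∩[≤ M ]) n = Y n × n ≤ M

boundedly-polynomial⇒LIP : ∀ {Y g} → (∀ M → PolynomialOn (Y ∩[≤ M ]) +_ g) → LIP Y g
boundedly-polynomial⇒LIP poly Z Z⊆Y with poly (max 0 Z)
... | p , p≡g = p , All.zipWith (λ {z} → p≡g z) (Z⊆Y , xs≤max 0 Z)

x-y∣p[x]-p[y] : ∀ p x y → x - y ℤ∣.∣ eval p x - eval p y
x-y∣p[x]-p[y] []      x y = ℤ∣.divides 0ℤ refl
x-y∣p[x]-p[y] (c ∷ p) x y = subst (x - y ℤ∣.∣_) (regroup c x y (eval p x) (eval p y))
  (ℤ∣.∣m∣n⇒∣m+n (ℤ∣.∣n⇒∣m*n x (x-y∣p[x]-p[y] p x y))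
                (ℤ∣.∣m⇒∣m*n (eval p y) ℤ∣.∣-refl))
  where
  regroup : ∀ c x y s t → x * (s - t) + (x - y) * t ≡ c + x * s - (c + y * t)
  regroup = solve-∀

LIP⇒m-n∣g[m]-g[n] : ∀ {Y g m n} → LIP Y g → Y m → Y n → + m - + n ℤ∣.∣ g m - g n
LIP⇒m-n∣g[m]-g[n] {m = m} {n} lip m∈Y n∈Y with lip (m ∷ n ∷ []) (m∈Y ∷ n∈Y ∷ [])
... | p , (p≡gm ∷ p≡gn ∷ []) =
  subst (+ m - + n ℤ∣.∣_) (cong₂ _-_ p≡gm p≡gn) (x-y∣p[x]-p[y] p (+ m) (+ n))

σ : ℕ → ℤ
σ 0 = 1ℤ
σ 1 = 1ℤ
σ 2 = 1ℤ
σ 3 = 1ℤ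
σ 4 = -1ℤ
σ 5 = 1ℤ
σ (suc (suc (suc (suc (suc (suc n)))))) = σ n

σ-1+2ℕ : ∀ k → σ (1 ℕ.+ 2 ℕ.* k) ≡ 1ℤ
σ-1+2ℕ 0 = refl
σ-1+2ℕ 1 = refl
σ-1+2ℕ 2 = refl
σ-1+2ℕ (suc (suc (suc k))) = trans (cong σ (shift k)) (σ-1+2ℕ k)
  where
  shift : ∀ k → 1 ℕ.+ 2 ℕ.* (3 ℕ.+ k) ≡ 6 ℕ.+ (1 ℕ.+ 2 ℕ.* k)
  shift = ℕ-Solver.solve-∀

σ-2+3ℕ : ∀ k → σ (2 ℕ.+ 3 ℕ.* k) ≡ 1ℤ
σ-2+3ℕ 0 = refl
σ-2+3ℕ 1 = refl
σ-2+3ℕ (suc (suc k)) = trans (cong σ (shift k)) (σ-2+3ℕ k)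
  where
  shift : ∀ k → 2 ℕ.+ 3 ℕ.* (2 ℕ.+ k) ≡ 6 ℕ.+ (2 ℕ.+ 3 ℕ.* k)
  shift = ℕ-Solver.solve-∀

σ-1+3ℕ : ∀ k → σ (1 ℕ.+ 3 ℕ.* k) ≡ -1ℤ ^ k
σ-1+3ℕ 0 = refl
σ-1+3ℕ 1 = refl
σ-1+3ℕ (suc (suc k)) = trans (cong σ (shift k)) (trans (σ-1+3ℕ k) (sign² (-1ℤ ^ k)))
  where
  shift : ∀ k → 1 ℕ.+ 3 ℕ.* (2 ℕ.+ k) ≡ 6 ℕ.+ (1 ℕ.+ 3 ℕ.* k)
  shift = ℕ-Solver.solve-∀
  sign² : ∀ s → s ≡ -1ℤ * (-1ℤ * s)
  sign² = solve-∀

f : ℕ → ℤ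
f n = ∑[ r ≤ n ] (Δ σ r 0 * + L r * + (n C r))

f-expansion : ∀ {n M} → n ≤ M → f n ≡ ∑[ r ≤ M ] (Δ σ r 0 * + L r * + (n C r))
f-expansion n≤M = sym (∑-extend _ n≤M (λ r → n<r⇒c*nCr≡0 (Δ σ r 0 * + L r)))

f-σ-expansion : ∀ {n M} → n ≤ M → f n ≡ σ n + ∑[ r ≤ M ] (Δ σ r 0 * + (L r ∸ 1) * + (n C r))
f-σ-expansion {n} {M} n≤M = begin
  f n
    ≡⟨ f-expansion n≤M ⟩
  ∑[ r ≤ M ] (Δ σ r 0 * + L r * + (n C r))
    ≡⟨ ∑-cong M (λ r _ → split r) ⟩
  ∑[ r ≤ M ] (Δ σ r 0 * + (n C r) + Δ σ r 0 * + (L r ∸ 1) * + (n C r))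
    ≡⟨ ∑-distrib-+ M _ _ ⟩
  ∑[ r ≤ M ] (Δ σ r 0 * + (n C r)) + correction
    ≡⟨ cong (_+ correction) (newton-forward σ n≤M) ⟨
  σ n + correction
    ∎
  where
  open ≡-Reasoning
  correction = ∑[ r ≤ M ] (Δ σ r 0 * + (L r ∸ 1) * + (n C r))
  split : ∀ r → Δ σ r 0 * + L r * + (n C r) ≡ Δ σ r 0 * + (n C r) + Δ σ r 0 * + (L r ∸ 1) * + (n C r)
  split r = trans (cong (λ l → Δ σ r 0 * + l * + (n C r)) (L[r]≡1+[L[r]∸1] r))
                  (trans (cong (λ l → Δ σ r 0 * l * + (n C r)) (ℤP.pos-+ 1 (L r ∸ 1)))
                         (expand (Δ σ r 0) (+ (L r ∸ 1)) (+ (n C r))))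
    where
    expand : ∀ w l c → w * (1ℤ + l) * c ≡ w * c + w * l * c
    expand = solve-∀

*-∑-absorb : ∀ M c (w : ℕ → ℤ) (l : ℕ → ℕ) (t : ℕ → ℤ) →
             + c * ∑[ r ≤ M ] (w r * + l r * t r) ≡ ∑[ r ≤ M ] (w r * (+ (c ℕ.* l r) * t r))
*-∑-absorb M c w l t = trans (*-distribˡ-∑ M (+ c) _) (∑-cong M (λ r _ →
  trans (regroup (+ c) (w r) (+ l r) (t r)) (cong (λ e → w r * (e * t r)) (sym (ℤP.pos-* c (l r))))))
  where
  regroup : ∀ c w l t → c * (w * l * t) ≡ w * (c * l * t)
  regroup = solve-∀

2^M*f-polynomial : ∀ M → PolynomialOn (_≤ M) +_ (λ n → + (2 ℕ.^ M) * f n)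
2^M*f-polynomial M = polynomialOn-cong (λ n n≤M → sym (expansion n≤M))
  (binomialSum-polynomialOn M (λ r → Δ σ r 0) (λ r → r!∣2^M*L[r] M))
  where
  expansion : ∀ {n} → n ≤ M →
    + (2 ℕ.^ M) * f n ≡ ∑[ r ≤ M ] (Δ σ r 0 * (+ (2 ℕ.^ M ℕ.* L r) * + (n C r)))
  expansion {n} n≤M = trans (cong (+ (2 ℕ.^ M) *_) (f-expansion n≤M))
                            (*-∑-absorb M (2 ℕ.^ M) (λ r → Δ σ r 0) L (λ r → + (n C r)))

D*f-polynomial : ∀ {Y} M → PolynomialOn (Y ∩[≤ M ]) +_ (λ n → + D M * σ n) →
                 PolynomialOn (Y ∩[≤ M ]) +_ (λ n → + D M * f n)
D*f-polynomial M Dσ = polynomialOn-cong (λ n (_ , n≤M) → sym (expansion n≤M))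
  (polynomialOn-+ Dσ (binomialSum-polynomialOn M (λ r → Δ σ r 0) (λ r → r!∣D[M]*[L[r]∸1] M)))
  where
  expansion : ∀ {n} → n ≤ M →
    + D M * f n ≡ + D M * σ n + ∑[ r ≤ M ] (Δ σ r 0 * (+ (D M ℕ.* (L r ∸ 1)) * + (n C r)))
  expansion {n} n≤M = begin
    + D M * f n
      ≡⟨ cong (+ D M *_) (f-σ-expansion n≤M) ⟩
    + D M * (σ n + ∑[ r ≤ M ] (Δ σ r 0 * + (L r ∸ 1) * + (n C r)))
      ≡⟨ ℤP.*-distribˡ-+ (+ D M) (σ n) _ ⟩
    + D M * σ n + + D M * ∑[ r ≤ M ] (Δ σ r 0 * + (L r ∸ 1) * + (n C r))
      ≡⟨ cong (_+_ (+ D M * σ n))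
              (*-∑-absorb M (D M) (λ r → Δ σ r 0) (λ r → L r ∸ 1) (λ r → + (n C r))) ⟩
    + D M * σ n + ∑[ r ≤ M ] (Δ σ r 0 * (+ (D M ℕ.* (L r ∸ 1)) * + (n C r)))
      ∎
    where open ≡-Reasoning

f-LIP : ∀ {Y} → (∀ M → PolynomialOn (Y ∩[≤ M ]) +_ (λ n → + D M * σ n)) → LIP Y f
f-LIP Dσ = boundedly-polynomial⇒LIP λ M →
  polynomialOn-bézout {b = 2 ℕ.^ M} (proj₂ (D[M]∣1+2^M*y M))
    (D*f-polynomial M (Dσ M))
    (polynomialOn-restrict (λ _ → proj₂) (2^M*f-polynomial M))

D*σ-polynomial-const : ∀ a d → (∀ k → σ (a ℕ.+ d ℕ.* k) ≡ 1ℤ) →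
                       ∀ M → PolynomialOn (AP a d ∩[≤ M ]) +_ (λ n → + D M * σ n)
D*σ-polynomial-const a d σ≡1 M = polynomialOn-cong
  (λ { n ((k , refl) , _) → trans (sym (ℤP.*-identityʳ (+ D M))) (cong (+ D M *_) (sym (σ≡1 k))) })
  (polynomialOn-const (+ D M))

D*alternating-expansion : ∀ {M k} → k ≤ M →
  + D M * -1ℤ ^ k ≡ ∑[ j ≤ M ] (-1ℤ ^ j * (+ (D M ℕ.* 2 ℕ.^ j) * + (k C j)))
D*alternating-expansion {M} {k} k≤M = begin
  + D M * -1ℤ ^ k
    ≡⟨ cong (+ D M *_) (newton-forward (-1ℤ ^_) k≤M) ⟩
  + D M * ∑[ j ≤ M ] (Δ (-1ℤ ^_) j 0 * + (k C j))
    ≡⟨ *-distribˡ-∑ M (+ D M) _ ⟩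
  ∑[ j ≤ M ] (+ D M * (Δ (-1ℤ ^_) j 0 * + (k C j)))
    ≡⟨ ∑-cong M (λ j _ → trans (cong (λ t → + D M * (t * + (k C j))) (Δ-alternating j 0))
         (trans (regroup (+ D M) (-1ℤ ^ j) (+ (2 ℕ.^ j)) (+ (k C j)))
                (cong (λ t → -1ℤ ^ j * (t * + (k C j))) (sym (ℤP.pos-* (D M) (2 ℕ.^ j)))))) ⟩
  ∑[ j ≤ M ] (-1ℤ ^ j * (+ (D M ℕ.* 2 ℕ.^ j) * + (k C j)))
    ∎
  where
  open ≡-Reasoning
  regroup : ∀ e s p c → e * (s * p * 1ℤ * c) ≡ s * (e * p * c)
  regroup = solve-∀

D*σ-polynomial-1+3ℕ : ∀ M → PolynomialOn (AP 1 3 ∩[≤ M ]) +_ (λ n → + D M * σ n)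
D*σ-polynomial-1+3ℕ M = proj₁ series , agrees
  where
  series : PolynomialOn (_≤ M) (λ k → + (1 ℕ.+ 3 ℕ.* k))
                        (λ k → ∑[ j ≤ M ] (-1ℤ ^ j * (+ (D M ℕ.* 2 ℕ.^ j) * + (k C j))))
  series = polynomialOn-∑ M (λ j j≤M →
    polynomialOn-scale (-1ℤ ^ j) (binomial-polynomialOn 1 3 j (3^j*j!∣D[M]*2^j M j≤M)))
  agrees : ∀ n → (AP 1 3 ∩[≤ M ]) n → eval (proj₁ series) (+ n) ≡ + D M * σ n
  agrees _ ((k , refl) , 1+3k≤M) = begin
    eval (proj₁ series) (+ (1 ℕ.+ 3 ℕ.* k))                   ≡⟨ proj₂ series k k≤M ⟩
    ∑[ j ≤ M ] (-1ℤ ^ j * (+ (D M ℕ.* 2 ℕ.^ j) * + (k C j)))  ≡⟨ D*alternating-expansion k≤M ⟨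
    + D M * -1ℤ ^ k                                          ≡⟨ cong (+ D M *_) (σ-1+3ℕ k) ⟨
    + D M * σ (1 ℕ.+ 3 ℕ.* k)                                 ∎
    where
    open ≡-Reasoning
    k≤M = ℕP.≤-trans (ℕP.≤-trans (ℕP.m≤n*m k 3) (ℕP.n≤1+n (3 ℕ.* k))) 1+3k≤M

neighbourhood : ∀ {a d n} → KirchBasic a d → a < d → d ℕ∣.∣ 6 → AP a d n → LIP (AP a d) f →
                Σ Subset λ U → KirchOpen U × (U ⊆ X) × U n × LIP U f
neighbourhood {a} {d} basic@(0<a , _) a<d d∣6 n∈AP lip =
  AP a d , basic⇒open basic , AP⊆X 0<a a<d d∣6 , n∈AP , lip

f-locally-LIP : LocallyLIP X f
f-locally-LIP n (_ , 6∤n) with X-cover n 6∤n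
... | inj₁ n∈AP        = neighbourhood basic[1,2] (s≤s (s≤s z≤n)) (divides 3 refl) n∈AP
                           (f-LIP (D*σ-polynomial-const 1 2 σ-1+2ℕ))
... | inj₂ (inj₁ n∈AP) = neighbourhood basic[2,3] (s≤s (s≤s (s≤s z≤n))) (divides 2 refl) n∈AP
                           (f-LIP (D*σ-polynomial-const 2 3 σ-2+3ℕ))
... | inj₂ (inj₂ n∈AP) = neighbourhood basic[1,3] (s≤s (s≤s z≤n)) (divides 2 refl) n∈AP
                           (f-LIP D*σ-polynomial-1+3ℕ)

-- The decision procedure evaluates f 8 − f 4, which is ≡ σ 8 − σ 4 = 2 (mod 4).
f-not-LIP : ¬ LIP X f
f-not-LIP lip = from-no (+ 4 ℤ∣.∣? f 8 - f 4)
  (LIP⇒m-n∣g[m]-g[n] lip (s≤s z≤n , from-no (6 ℕ∣.∣? 8)) (s≤s z≤n , from-no (6 ℕ∣.∣? 4)))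

mainTheorem8 : Σ (ℕ → ℤ) λ f → LocallyLIP X f × ¬ LIP X f
mainTheorem8 = f , f-locally-LIP , f-not-LIP
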